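{- Let $(V;\mathfrak f,\mathfrak g)$ be a dual-modular instance with density decomposition $V=S_1\cup\dots\cup S_k$ and densities $\rho_1>\dots>\rho_k$. If $\gamma\in\mathbb R$ and $i$ is an index with $\rho_i>\gamma>\rho_{i+1}$, then $S_{\le i}:=\bigcup_{j=1}^iS_j$ is the unique maximizer of $\mathfrak f(S)-\gamma\,\mathfrak g(S)$ over $S\subseteq V$.
   Context: $V$ is a finite ground set. A dual-modular instance $(V;\mathfrak f,\mathfrak g)$ consists of $\mathfrak f,\mathfrak g:2^V\to\mathbb R_{\ge0}$ with $\mathfrak f(\emptyset)=\mathfrak g(\emptyset)=0$, $\mathfrak f$ monotone and supermodular, $\mathfrak g$ submodular and strictly monotone ($A\subsetneq B\Rightarrow\mathfrak g(A)<\mathfrak g(B)$). $h(S\mid A)=h(S\cup A)-h(A)$. Density decomposition: $S_0=\emptyset$; for $i\ge1$, with $S_{<i}=\bigcup_{j<i}S_j$ and $V_i=V\setminus S_{<i}\ne\emptyset$, $S_i$ is the (unique) inclusion-maximal nonempty $S\subseteq V_i$ maximizing $\mathfrak f(S\mid S_{<i})/\mathfrak g(S\mid S_{<i})$ and $\rho_i$ is the maximum value; stop when $S_i=V_i$. -}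

module Defs where

open import Level using (0ℓ)
open import Data.Nat using (ℕ; zero; suc) renaming (_<_ to _<ℕ_)
open import Data.Fin.Subset using (Subset; _⊆_; _⊂_; _∪_; _∩_; ∁; ⊥; ⊤; Nonempty)
open import Data.Product using (Σ; ∃; _×_; _,_)
open import Data.Sum using (_⊎_)
open import Relation.Binary.PropositionalEquality using (_≡_)
open import Relation.Binary.Core using (Rel)
open import Relation.Binary.Definitions using (Trichotomous)
open import Relation.Nullary using (¬_)

-- The real numbers, axiomatised as a complete ordered field
-- (agda-stdlib has no reals).  Any model of this record is isomorphic
-- to ℝ; the theorem is stated for every such model.

record RealField : Set₁ where
  infixl 6 _+_ _-_
  infixl 7 _*_
  infix 4 _<_ _≤_
  field
    Carrier : Set
    0# 1#   : Carrier
    _+_ _*_ : Carrier → Carrier → Carrier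
    -_      : Carrier → Carrier
    _⁻¹     : Carrier → Carrier
    _<_     : Rel Carrier 0ℓ
    +-assoc     : ∀ x y z → (x + y) + z ≡ x + (y + z)
    +-comm      : ∀ x y → x + y ≡ y + x
    +-identityʳ : ∀ x → x + 0# ≡ x
    -‿inverseʳ  : ∀ x → x + (- x) ≡ 0#
    *-assoc     : ∀ x y z → (x * y) * z ≡ x * (y * z)
    *-comm      : ∀ x y → x * y ≡ y * x
    *-identityʳ : ∀ x → x * 1# ≡ x
    distribˡ    : ∀ x y z → x * (y + z) ≡ x * y + x * z
    0≢1         : ¬ (0# ≡ 1#)
    ⁻¹-inverseʳ : ∀ x → ¬ (x ≡ 0#) → x * (x ⁻¹) ≡ 1#
    <-irrefl    : ∀ x → ¬ (x < x)
    <-trans     : ∀ {x y z} → x < y → y < z → x < z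
    <-tri       : Trichotomous _≡_ _<_
    +-mono-<    : ∀ {x y} z → x < y → x + z < y + z
    *-pos       : ∀ {x y} → 0# < x → 0# < y → 0# < x * y
    sup : (P : Carrier → Set) → (∃ λ x → P x) → (∃ λ b → ∀ x → P x → x < b ⊎ x ≡ b) →
          ∃ λ s → (∀ x → P x → x < s ⊎ x ≡ s) ×
                  (∀ b → (∀ x → P x → x < b ⊎ x ≡ b) → s < b ⊎ s ≡ b)

  _≤_ : Rel Carrier 0ℓ
  x ≤ y = x < y ⊎ x ≡ y

  _-_ : Carrier → Carrier → Carrier
  x - y = x + (- y)

  _/_ : Carrier → Carrier → Carrier
  x / y = x * (y ⁻¹)

module _ (R : RealField) where
  open RealField R

  record DualModular (n : ℕ) : Set where
    field
      f g          : Subset n → Carrier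
      f-nonneg     : ∀ A → 0# ≤ f A
      g-nonneg     : ∀ A → 0# ≤ g A
      f-empty      : f ⊥ ≡ 0#
      g-empty      : g ⊥ ≡ 0#
      f-monotone   : ∀ A B → A ⊆ B → f A ≤ f B
      f-supermod   : ∀ A B → f A + f B ≤ f (A ∪ B) + f (A ∩ B)
      g-submod     : ∀ A B → g (A ∪ B) + g (A ∩ B) ≤ g A + g B
      g-strictmono : ∀ A B → A ⊂ B → g A < g B

    f∣ : Subset n → Subset n → Carrier
    f∣ S A = f (S ∪ A) - f A

    g∣ : Subset n → Subset n → Carrier
    g∣ S A = g (S ∪ A) - g A

    ratio : Subset n → Subset n → Carrier
    ratio S A = f∣ S A / g∣ S A

  -- Density decomposition, 0-indexed: parts S 0, …, S (k-1) with
  -- densities ρ 0, …, ρ (k-1).  (Paper's S_i is S (i-1) here.)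

  module _ {n : ℕ} (I : DualModular n) where
    open DualModular I

    -- prefix union: Pre S i = S 0 ∪ … ∪ S (i-1)   (paper: S_{<i+1}, S_{≤ i})
    Pre : (ℕ → Subset n) → ℕ → Subset n
    Pre S zero    = ⊥
    Pre S (suc i) = Pre S i ∪ S i

    IsDensestStep : Subset n → Carrier → Subset n → Set
    IsDensestStep P r T =
      T ⊆ ∁ P × Nonempty T × ratio T P ≡ r ×
      (∀ U → U ⊆ ∁ P → Nonempty U → ratio U P ≤ r)

    record IsDensityDecomposition (k : ℕ) (S : ℕ → Subset n) (ρ : ℕ → Carrier) : Set where
      field
        step-max   : ∀ i → i <ℕ k → IsDensestStep (Pre S i) (ρ i) (S i)
        step-incl  : ∀ i → i <ℕ k → ∀ T → IsDensestStep (Pre S i) (ρ i) T → ¬ (S i ⊂ T)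
        covers     : Pre S k ≡ ⊤

{-# OPTIONS --safe #-}
module Submission where

open import Defs
open import Level using (0ℓ)
open import Algebra.Bundles using (CommutativeRing)
open import Algebra.Structures using (IsCommutativeRing)
open import Algebra.Solver.Ring.AlmostCommutativeRing using (_-Raw-AlmostCommutative⟶_; fromCommutativeRing)
open import Data.Nat as ℕ using (ℕ; zero; suc; z≤n; s≤s) renaming (_<_ to _<ℕ_; _≤_ to _≤ℕ_)
import Data.Nat.Properties as ℕₚ
open import Data.Integer as ℤ using (ℤ; -[1+_]; _⊖_)
open import Data.Integer.Properties using ([1+m]⊖[1+n]≡m⊖n)
open import Data.Sign as Sign using ()
open import Data.Fin.Subset using (Subset; _∈_; _⊆_; _⊂_; _∪_; _∩_; ∁; Nonempty)
open import Data.Fin.Subset.Properties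
  using (_∈?_; nonempty?; ⊆-trans; Empty-unique; ⊆-antisym; ⊥⊆; p⊆p∪q; q⊆p∪q; p∩q⊆p; p∩q⊆q;
         x∈p∪q⁻; x∈p∩q⁺; x∈p∩q⁻; x∉p⇒x∈∁p; x∈∁p⇒x∉p; ∪-comm; ∪-identityˡ; ∪-abs-∩)
open import Data.Product using (_×_; _,_; proj₁; proj₂)
open import Data.Sum using (_⊎_; inj₁; inj₂; [_,_]′)
open import Data.Maybe using (just; nothing)
open import Data.Empty using (⊥-elim)
open import Relation.Nullary using (¬_; yes; no)
open import Relation.Binary.Bundles using (StrictPartialOrder)
open import Relation.Binary.Structures using (IsStrictPartialOrder)
open import Relation.Binary.Definitions using (WeaklyDecidable; tri<; tri≈; tri>)
open import Relation.Binary.PropositionalEquality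
  using (_≡_; refl; sym; trans; cong; cong₂; subst; subst₂; isEquivalence; resp₂; module ≡-Reasoning)
import Relation.Binary.Reasoning.StrictPartialOrder

-- For γ ≥ 0 the function h = f - γ g is supermodular, so h T + h P ≤ h (T ∪ P) + h (T ∩ P)
-- with P = S_{≤i}, and it suffices that P strictly beats each proper superset and each proper
-- subset of itself.  Over P a proper superset only adds elements of density at most
-- ρ_{i+1} < γ, which lowers h.  Subsets are handled by induction over the prefixes S_{<j},
-- j ≤ i + 1: completing a set between S_{<j} and S_{≤j} to S_{≤j} gains at least ρ_j > γ in f
-- per unit of g, and supermodularity against S_{<j} splits an arbitrary subset of S_{≤j} into
-- such a set and a subset of S_{<j}.  Finally γ > ρ_{i+1} ≥ 0 since f is monotone, and
-- ρ_j ≥ ρ_i > γ for j ≤ i since the densities of consecutive steps do not increase.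

-- Tactic.RingSolver uses the carrier itself as coefficients and needs a zero test on them to
-- see cancellations, which an axiomatised field lacks; integer coefficients can be compared.
module IntegerCoefficientSolver {c ℓ} (CR : CommutativeRing c ℓ) where
  open CommutativeRing CR renaming (refl to ≈-refl; sym to ≈-sym; trans to ≈-trans)
  open import Algebra.Properties.Ring ring
    using (-0#≈0#; -‿involutive; -‿+-comm; -‿distribˡ-*; -‿distribʳ-*)
  open import Algebra.Properties.Semiring.Mult semiring
    using (×-homo-+; ×1-homo-*) renaming (_×_ to _·_)
  open import Relation.Binary.Reasoning.Setoid setoid

  ⟦_⟧ℤ : ℤ → Carrier
  ⟦ ℤ.+ m ⟧ℤ     = m · 1#
  ⟦ -[1+ m ] ⟧ℤ = - (suc m · 1#)

  [c+x]-[c+y]≈x-y : ∀ c x y → (c + x) - (c + y) ≈ x - y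
  [c+x]-[c+y]≈x-y c x y = begin
    (c + x) + - (c + y)     ≈⟨ +-cong (+-comm c x) (≈-sym (-‿+-comm c y)) ⟩
    (x + c) + (- c + - y)   ≈⟨ +-assoc x c _ ⟩
    x + (c + (- c + - y))   ≈⟨ +-congˡ (≈-sym (+-assoc c (- c) (- y))) ⟩
    x + ((c + - c) + - y)   ≈⟨ +-congˡ (+-congʳ (-‿inverseʳ c)) ⟩
    x + (0# + - y)          ≈⟨ +-congˡ (+-identityˡ (- y)) ⟩
    x - y                   ∎

  ⊖-homo : ∀ m n → ⟦ m ⊖ n ⟧ℤ ≈ m · 1# - n · 1#
  ⊖-homo zero    zero    = ≈-sym (-‿inverseʳ 0#)
  ⊖-homo zero    (suc n) = ≈-sym (+-identityˡ _)
  ⊖-homo (suc m) zero    = ≈-sym (≈-trans (+-congˡ -0#≈0#) (+-identityʳ _))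
  ⊖-homo (suc m) (suc n) = begin
    ⟦ suc m ⊖ suc n ⟧ℤ               ≡⟨ cong ⟦_⟧ℤ ([1+m]⊖[1+n]≡m⊖n m n) ⟩
    ⟦ m ⊖ n ⟧ℤ                       ≈⟨ ⊖-homo m n ⟩
    m · 1# - n · 1#                  ≈⟨ [c+x]-[c+y]≈x-y 1# _ _ ⟨
    suc m · 1# - suc n · 1#          ∎

  +-homo : ∀ i j → ⟦ i ℤ.+ j ⟧ℤ ≈ ⟦ i ⟧ℤ + ⟦ j ⟧ℤ
  +-homo (ℤ.+ m)  (ℤ.+ n)  = ×-homo-+ 1# m n
  +-homo (ℤ.+ m)  -[1+ n ] = ⊖-homo m (suc n)
  +-homo -[1+ m ] (ℤ.+ n)  = ≈-trans (⊖-homo n (suc m)) (+-comm _ _)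
  +-homo -[1+ m ] -[1+ n ] = begin
    - (suc (suc (m ℕ.+ n)) · 1#)     ≡⟨ cong (λ k → - (k · 1#)) (sym (ℕₚ.+-suc (suc m) n)) ⟩
    - ((suc m ℕ.+ suc n) · 1#)       ≈⟨ -‿cong (×-homo-+ 1# (suc m) (suc n)) ⟩
    - (suc m · 1# + suc n · 1#)      ≈⟨ -‿+-comm _ _ ⟨
    - (suc m · 1#) + - (suc n · 1#)  ∎

  ◃-homo-+ : ∀ k → ⟦ Sign.+ ℤ.◃ k ⟧ℤ ≈ k · 1#
  ◃-homo-+ zero    = ≈-refl
  ◃-homo-+ (suc k) = ≈-refl

  ◃-homo-- : ∀ k → ⟦ Sign.- ℤ.◃ k ⟧ℤ ≈ - (k · 1#)
  ◃-homo-- zero    = ≈-sym -0#≈0#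
  ◃-homo-- (suc k) = ≈-refl

  *-homo : ∀ i j → ⟦ i ℤ.* j ⟧ℤ ≈ ⟦ i ⟧ℤ * ⟦ j ⟧ℤ
  *-homo (ℤ.+ m)  (ℤ.+ n)  = ≈-trans (◃-homo-+ (m ℕ.* n)) (×1-homo-* m n)
  *-homo (ℤ.+ m)  -[1+ n ] =
    ≈-trans (◃-homo-- (m ℕ.* suc n)) (≈-trans (-‿cong (×1-homo-* m (suc n))) (-‿distribʳ-* _ _))
  *-homo -[1+ m ] (ℤ.+ n)  =
    ≈-trans (◃-homo-- (suc m ℕ.* n)) (≈-trans (-‿cong (×1-homo-* (suc m) n)) (-‿distribˡ-* _ _))
  *-homo -[1+ m ] -[1+ n ] = begin
    ⟦ Sign.+ ℤ.◃ (suc m ℕ.* suc n) ⟧ℤ  ≈⟨ ◃-homo-+ (suc m ℕ.* suc n) ⟩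
    (suc m ℕ.* suc n) · 1#             ≈⟨ ×1-homo-* (suc m) (suc n) ⟩
    a * b                              ≈⟨ -‿involutive _ ⟨
    - - (a * b)                        ≈⟨ -‿cong (-‿distribʳ-* a b) ⟩
    - (a * - b)                        ≈⟨ -‿distribˡ-* a (- b) ⟩
    - a * - b                          ∎
    where
    a b : Carrier
    a = suc m · 1#
    b = suc n · 1#

  -‿homo : ∀ i → ⟦ ℤ.- i ⟧ℤ ≈ - ⟦ i ⟧ℤ
  -‿homo -[1+ n ]      = ≈-sym (-‿involutive _)
  -‿homo (ℤ.+ zero)    = ≈-sym -0#≈0#
  -‿homo (ℤ.+ (suc n)) = ≈-refl

  ℤ-morphism : ℤ.+-*-rawRing -Raw-AlmostCommutative⟶ fromCommutativeRing CR
  ℤ-morphism = record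
    { ⟦_⟧ = ⟦_⟧ℤ ; +-homo = +-homo ; *-homo = *-homo ; -‿homo = -‿homo
    ; 0-homo = ≈-refl ; 1-homo = +-identityʳ 1# }

  _≟ℤ_ : WeaklyDecidable (λ i j → ⟦ i ⟧ℤ ≈ ⟦ j ⟧ℤ)
  i ≟ℤ j with i ℤ.≟ j
  ... | yes refl = just ≈-refl
  ... | no _     = nothing

  open import Algebra.Solver.Ring ℤ.+-*-rawRing (fromCommutativeRing CR) ℤ-morphism _≟ℤ_ public
    using (solve; _:=_; _:+_; _:-_; _:*_; :-_)

module RealFieldProperties (R : RealField) where
  open RealField R

  +-*-isCommutativeRing : IsCommutativeRing _≡_ _+_ _*_ -_ 0# 1#
  +-*-isCommutativeRing = record
    { isRing = record
      { +-isAbelianGroup = record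
        { isGroup = record
          { isMonoid = record
            { isSemigroup = record
              { isMagma = record { isEquivalence = isEquivalence ; ∙-cong = cong₂ _+_ }
              ; assoc = +-assoc }
            ; identity = +-identityˡ , +-identityʳ }
          ; inverse = -‿inverseˡ , -‿inverseʳ
          ; ⁻¹-cong = cong (λ x → - x) }
        ; comm = +-comm }
      ; *-cong = cong₂ _*_
      ; *-assoc = *-assoc
      ; *-identity = *-identityˡ , *-identityʳ
      ; distrib = distribˡ , distribʳ }
    ; *-comm = *-comm }
    where
    +-identityˡ : ∀ x → 0# + x ≡ x
    +-identityˡ x = trans (+-comm 0# x) (+-identityʳ x)
    -‿inverseˡ : ∀ x → - x + x ≡ 0#
    -‿inverseˡ x = trans (+-comm (- x) x) (-‿inverseʳ x)
    *-identityˡ : ∀ x → 1# * x ≡ x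
    *-identityˡ x = trans (*-comm 1# x) (*-identityʳ x)
    distribʳ : ∀ x y z → (y + z) * x ≡ y * x + z * x
    distribʳ x y z =
      trans (*-comm (y + z) x) (trans (distribˡ x y z) (cong₂ _+_ (*-comm x y) (*-comm x z)))

  commutativeRing : CommutativeRing 0ℓ 0ℓ
  commutativeRing = record { isCommutativeRing = +-*-isCommutativeRing }

  open CommutativeRing commutativeRing public using (+-identityˡ; zeroˡ)
  open import Algebra.Properties.Ring (CommutativeRing.ring commutativeRing) public
    using (x[y-z]≈xy-xz; [y-z]x≈yx-zx)
  open IntegerCoefficientSolver commutativeRing public

  <-isStrictPartialOrder : IsStrictPartialOrder _≡_ _<_
  <-isStrictPartialOrder = record
    { isEquivalence = isEquivalence
    ; irrefl        = λ { refl → <-irrefl _ }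
    ; trans         = <-trans
    ; <-resp-≈      = resp₂ _<_
    }

  <-strictPartialOrder : StrictPartialOrder 0ℓ 0ℓ 0ℓ
  <-strictPartialOrder = record { isStrictPartialOrder = <-isStrictPartialOrder }

  module ≤-Reasoning = Relation.Binary.Reasoning.StrictPartialOrder <-strictPartialOrder

  x≡y+[x-y] : ∀ x y → x ≡ y + (x - y)
  x≡y+[x-y] = solve 2 (λ x y → x := y :+ (x :- y)) refl

  +-monoʳ-< : ∀ {x y} z → x < y → z + x < z + y
  +-monoʳ-< {x} {y} z x<y = subst₂ _<_ (+-comm x z) (+-comm y z) (+-mono-< z x<y)

  +-monoˡ-≤ : ∀ {x y} z → x ≤ y → x + z ≤ y + z
  +-monoˡ-≤ z (inj₁ x<y)  = inj₁ (+-mono-< z x<y)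
  +-monoˡ-≤ z (inj₂ refl) = inj₂ refl

  +-monoʳ-≤ : ∀ {x y} z → x ≤ y → z + x ≤ z + y
  +-monoʳ-≤ z (inj₁ x<y)  = inj₁ (+-monoʳ-< z x<y)
  +-monoʳ-≤ z (inj₂ refl) = inj₂ refl

  +-mono-<-≤ : ∀ {x y u v} → x < y → u ≤ v → x + u < y + v
  +-mono-<-≤ {x} {y} {u} {v} x<y u≤v = begin-strict
    x + u  <⟨ +-mono-< u x<y ⟩
    y + u  ≤⟨ +-monoʳ-≤ y u≤v ⟩
    y + v  ∎
    where open ≤-Reasoning

  +-cancelʳ-< : ∀ {x y} z → x + z < y + z → x < y
  +-cancelʳ-< {x} {y} z x+z<y+z = subst₂ _<_ (cancel x) (cancel y) (+-mono-< (- z) x+z<y+z)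
    where
    cancel : ∀ w → w + z - z ≡ w
    cancel w = solve 2 (λ w z → w :+ z :- z := w) refl w z

  -‿antimono-≤ : ∀ {x y} → x ≤ y → - y ≤ - x
  -‿antimono-≤ {x} {y} x≤y = subst₂ _≤_ x+[-x-y]≡-y y+[-x-y]≡-x (+-monoˡ-≤ (- x - y) x≤y)
    where
    x+[-x-y]≡-y : x + (- x - y) ≡ - y
    x+[-x-y]≡-y = solve 2 (λ x y → x :+ (:- x :- y) := :- y) refl x y
    y+[-x-y]≡-x : y + (- x - y) ≡ - x
    y+[-x-y]≡-x = solve 2 (λ x y → y :+ (:- x :- y) := :- x) refl x y

  x<y⇒0<y-x : ∀ {x y} → x < y → 0# < y - x
  x<y⇒0<y-x {x} x<y = subst (_< _) (-‿inverseʳ x) (+-mono-< (- x) x<y)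

  x<y⇒x-y<0 : ∀ {x y} → x < y → x - y < 0#
  x<y⇒x-y<0 {y = y} x<y = subst (_ <_) (-‿inverseʳ y) (+-mono-< (- y) x<y)

  0<y-x⇒x<y : ∀ {x y} → 0# < y - x → x < y
  0<y-x⇒x<y {x} {y} 0<y-x =
    subst₂ _<_ (+-identityˡ x) (solve 2 (λ x y → y :- x :+ x := y) refl x y) (+-mono-< x 0<y-x)

  x≤y⇒0≤y-x : ∀ {x y} → x ≤ y → 0# ≤ y - x
  x≤y⇒0≤y-x (inj₁ x<y)      = inj₁ (x<y⇒0<y-x x<y)
  x≤y⇒0≤y-x {x} (inj₂ refl) = inj₂ (sym (-‿inverseʳ x))

  *-monoˡ-<-pos : ∀ {x y z} → 0# < z → x < y → z * x < z * y
  *-monoˡ-<-pos {x} {y} {z} 0<z x<y =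
    0<y-x⇒x<y (subst (0# <_) (x[y-z]≈xy-xz z y x) (*-pos 0<z (x<y⇒0<y-x x<y)))

  *-monoʳ-<-pos : ∀ {x y z} → 0# < z → x < y → x * z < y * z
  *-monoʳ-<-pos {x} {y} {z} 0<z x<y =
    subst₂ _<_ (*-comm z x) (*-comm z y) (*-monoˡ-<-pos 0<z x<y)

  *-monoˡ-≤-nonNeg : ∀ {x y z} → 0# ≤ z → x ≤ y → z * x ≤ z * y
  *-monoˡ-≤-nonNeg         (inj₁ 0<z)  (inj₁ x<y)  = inj₁ (*-monoˡ-<-pos 0<z x<y)
  *-monoˡ-≤-nonNeg {x} {y} (inj₂ refl) (inj₁ _)    = inj₂ (trans (zeroˡ x) (sym (zeroˡ y)))
  *-monoˡ-≤-nonNeg         _           (inj₂ refl) = inj₂ refl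

  *-monoʳ-≤-nonNeg : ∀ {x y z} → 0# ≤ z → x ≤ y → x * z ≤ y * z
  *-monoʳ-≤-nonNeg {x} {y} {z} 0≤z x≤y =
    subst₂ _≤_ (*-comm z x) (*-comm z y) (*-monoˡ-≤-nonNeg 0≤z x≤y)

  *-cancelʳ-≤-pos : ∀ {x y z} → 0# < z → x * z ≤ y * z → x ≤ y
  *-cancelʳ-≤-pos {x} {y} {z} 0<z xz≤yz with <-tri x y
  ... | tri< x<y _ _ = inj₁ x<y
  ... | tri≈ _ x≡y _ = inj₂ x≡y
  ... | tri> _ _ y<x = ⊥-elim (<-irrefl (y * z) (begin-strict
    y * z  <⟨ *-monoʳ-<-pos 0<z y<x ⟩
    x * z  ≤⟨ xz≤yz ⟩
    y * z  ∎))
    where open ≤-Reasoning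

  /-*-inverse : ∀ {x d} → 0# < d → (x / d) * d ≡ x
  /-*-inverse {x} {d} 0<d = begin
    (x * d ⁻¹) * d  ≡⟨ *-assoc x (d ⁻¹) d ⟩
    x * (d ⁻¹ * d)  ≡⟨ cong (x *_) (*-comm (d ⁻¹) d) ⟩
    x * (d * d ⁻¹)  ≡⟨ cong (x *_) (⁻¹-inverseʳ d d≢0) ⟩
    x * 1#          ≡⟨ *-identityʳ x ⟩
    x               ∎
    where
    open ≡-Reasoning
    d≢0 : ¬ d ≡ 0#
    d≢0 d≡0 = <-irrefl 0# (subst (0# <_) d≡0 0<d)

  /-≤⇒≤-* : ∀ {x d r} → 0# < d → x / d ≤ r → x ≤ r * d
  /-≤⇒≤-* 0<d x/d≤r = subst (_≤ _) (/-*-inverse 0<d) (*-monoʳ-≤-nonNeg (inj₁ 0<d) x/d≤r)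

  /-≡⇒≡-* : ∀ {x d r} → 0# < d → x / d ≡ r → x ≡ r * d
  /-≡⇒≡-* {d = d} 0<d refl = sym (/-*-inverse 0<d)

  ≤-<-trans : ∀ {x y z} → x ≤ y → y < z → x < z
  ≤-<-trans (inj₁ x<y)  y<z = <-trans x<y y<z
  ≤-<-trans (inj₂ refl) y<z = y<z

  <-≤-trans : ∀ {x y z} → x < y → y ≤ z → x < z
  <-≤-trans x<y (inj₁ y<z)  = <-trans x<y y<z
  <-≤-trans x<y (inj₂ refl) = x<y

  ≤-trans : ∀ {x y z} → x ≤ y → y ≤ z → x ≤ z
  ≤-trans (inj₁ x<y)  y≤z = inj₁ (<-≤-trans x<y y≤z)
  ≤-trans (inj₂ refl) y≤z = y≤z

p⊆q⇒p≡q∨p⊂q : ∀ {n} {p q : Subset n} → p ⊆ q → p ≡ q ⊎ p ⊂ q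
p⊆q⇒p≡q∨p⊂q {p = p} {q} p⊆q with nonempty? (q ∩ ∁ p)
... | yes (x , x∈q∩∁p) = inj₂ (p⊆q , x , x∈q , x∈∁p⇒x∉p x∈∁p)
  where
  x∈q : x ∈ q
  x∈q = proj₁ (x∈p∩q⁻ q (∁ p) x∈q∩∁p)
  x∈∁p : x ∈ ∁ p
  x∈∁p = proj₂ (x∈p∩q⁻ q (∁ p) x∈q∩∁p)
... | no q∩∁p-empty = inj₁ (⊆-antisym p⊆q q⊆p)
  where
  q⊆p : q ⊆ p
  q⊆p {x} x∈q with x ∈? p
  ... | yes x∈p = x∈p
  ... | no  x∉p = ⊥-elim (q∩∁p-empty (x , x∈p∩q⁺ (x∈q , x∉p⇒x∈∁p x∉p)))

∪-least : ∀ {n} {p q r : Subset n} → p ⊆ r → q ⊆ r → p ∪ q ⊆ r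
∪-least {p = p} {q} p⊆r q⊆r x∈p∪q = [ p⊆r , q⊆r ]′ (x∈p∪q⁻ p q x∈p∪q)

q⊆p⇒p∩∁q∪q≡p : ∀ {n} {p q : Subset n} → q ⊆ p → p ∩ ∁ q ∪ q ≡ p
q⊆p⇒p∩∁q∪q≡p {p = p} {q} q⊆p = ⊆-antisym (∪-least (p∩q⊆p p (∁ q)) q⊆p) p⊆
  where
  p⊆ : p ⊆ p ∩ ∁ q ∪ q
  p⊆ {x} x∈p with x ∈? q
  ... | yes x∈q = q⊆p∪q (p ∩ ∁ q) q x∈q
  ... | no  x∉q = p⊆p∪q q (x∈p∩q⁺ (x∈p , x∉p⇒x∈∁p x∉q))

module DualModularProperties (R : RealField) {n : ℕ} (I : DualModular R n) where
  open RealField R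
  open RealFieldProperties R
  open DualModular I

  g-marginal-pos : ∀ {A U} → U ⊆ ∁ A → Nonempty U → 0# < g (U ∪ A) - g A
  g-marginal-pos {A} {U} U⊆∁A (x , x∈U) =
    x<y⇒0<y-x (g-strictmono A (U ∪ A) (q⊆p∪q U A , x , p⊆p∪q A x∈U , x∈∁p⇒x∉p (U⊆∁A x∈U)))

  densest-g-pos : ∀ {A r B} → IsDensestStep R I A r B → 0# < g (A ∪ B) - g A
  densest-g-pos {A} {B = B} (B⊆∁A , B≠∅ , _) =
    subst (λ X → 0# < g X - g A) (∪-comm B A) (g-marginal-pos B⊆∁A B≠∅)

  densest-≡ : ∀ {A r B} → IsDensestStep R I A r B → f (A ∪ B) - f A ≡ r * (g (A ∪ B) - g A)
  densest-≡ {A} {r} {B} (B⊆∁A , B≠∅ , ratio≡r , _) =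
    subst (λ X → f X - f A ≡ r * (g X - g A)) (∪-comm B A)
      (/-≡⇒≡-* (g-marginal-pos B⊆∁A B≠∅) ratio≡r)

  densest-≤ : ∀ {A r B} → IsDensestStep R I A r B → ∀ X → A ⊆ X → f X - f A ≤ r * (g X - g A)
  densest-≤ {A} {r} (_ , _ , _ , maximal) X A⊆X =
    subst (λ Y → f Y - f A ≤ r * (g Y - g A)) (q⊆p⇒p∩∁q∪q≡p A⊆X)
      (bound (X ∩ ∁ A) (p∩q⊆q X (∁ A)))
    where
    bound : ∀ U → U ⊆ ∁ A → f (U ∪ A) - f A ≤ r * (g (U ∪ A) - g A)
    bound U U⊆∁A with nonempty? U
    ... | yes U≠∅ = /-≤⇒≤-* (g-marginal-pos U⊆∁A U≠∅) (maximal U U⊆∁A U≠∅)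
    ... | no  U=∅ rewrite Empty-unique U=∅ | ∪-identityˡ A =
      inj₂ (solve 3 (λ x y r → x :- x := r :* (y :- y)) refl (f A) (g A) r)

  densest-nonNeg : ∀ {A r B} → IsDensestStep R I A r B → 0# ≤ r
  densest-nonNeg {A} {r} {B} step = *-cancelʳ-≤-pos (densest-g-pos step) (begin
    0# * (g (A ∪ B) - g A)  ≡⟨ zeroˡ _ ⟩
    0#                      ≤⟨ x≤y⇒0≤y-x (f-monotone A (A ∪ B) (p⊆p∪q B)) ⟩
    f (A ∪ B) - f A         ≡⟨ densest-≡ step ⟩
    r * (g (A ∪ B) - g A)   ∎)
    where open ≤-Reasoning

  densest-antitone : ∀ {A r B r′ C} →
                     IsDensestStep R I A r B → IsDensestStep R I (A ∪ B) r′ C → r′ ≤ r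
  densest-antitone {A} {r} {B} {r′} {C} step step′ = *-cancelʳ-≤-pos (densest-g-pos step′) (begin
    r′ * (g A″ - g A′)                   ≡⟨ sym (densest-≡ step′) ⟩
    f A″ - f A′                          ≡⟨ telescope (f A″) (f A′) (f A) ⟩
    (f A″ - f A) - (f A′ - f A)          ≤⟨ +-monoˡ-≤ _ (densest-≤ step A″ A⊆A″) ⟩
    r * (g A″ - g A) - (f A′ - f A)      ≡⟨ cong (λ t → r * (g A″ - g A) - t) (densest-≡ step) ⟩
    r * (g A″ - g A) - r * (g A′ - g A)  ≡⟨ x[y-z]≈xy-xz r _ _ ⟨
    r * ((g A″ - g A) - (g A′ - g A))    ≡⟨ cong (r *_) (telescope (g A″) (g A′) (g A)) ⟨
    r * (g A″ - g A′)                    ∎)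
    where
    open ≤-Reasoning
    A′ A″ : Subset n
    A′ = A ∪ B
    A″ = A′ ∪ C
    A⊆A″ : A ⊆ A″
    A⊆A″ = ⊆-trans (p⊆p∪q B) (p⊆p∪q C)
    telescope : ∀ x y z → x - y ≡ (x - z) - (y - z)
    telescope = solve 3 (λ x y z → x :- y := (x :- z) :- (y :- z)) refl

  module Penalised (γ : Carrier) where

    h : Subset n → Carrier
    h X = f X - γ * g X

    infix 4 _⊴_
    _⊴_ : Subset n → Subset n → Set
    Y ⊴ Q = h Y < h Q ⊎ Y ≡ Q

    ⊴⇒≤ : ∀ {Y Q} → Y ⊴ Q → h Y ≤ h Q
    ⊴⇒≤ (inj₁ hY<hQ) = inj₁ hY<hQ
    ⊴⇒≤ (inj₂ refl)  = inj₂ refl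

    ⊴∧h≡⇒≡ : ∀ {Y Q} → Y ⊴ Q → h Y ≡ h Q → Y ≡ Q
    ⊴∧h≡⇒≡ {Q = Q} (inj₁ hY<hQ) hY≡hQ = ⊥-elim (<-irrefl (h Q) (subst (_< h Q) hY≡hQ hY<hQ))
    ⊴∧h≡⇒≡         (inj₂ Y≡Q)   _     = Y≡Q

    h-supermodular : 0# ≤ γ → ∀ A B → h A + h B ≤ h (A ∪ B) + h (A ∩ B)
    h-supermodular 0≤γ A B = begin
      h A + h B                                              ≡⟨ regroup (f A) (f B) (g A) (g B) ⟩
      (f A + f B) - γ * (g A + g B)                          ≤⟨ +-monoˡ-≤ _ (f-supermod A B) ⟩
      (f (A ∪ B) + f (A ∩ B)) - γ * (g A + g B)
        ≤⟨ +-monoʳ-≤ _ (-‿antimono-≤ (*-monoˡ-≤-nonNeg 0≤γ (g-submod A B))) ⟩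
      (f (A ∪ B) + f (A ∩ B)) - γ * (g (A ∪ B) + g (A ∩ B))
        ≡⟨ regroup (f (A ∪ B)) (f (A ∩ B)) (g (A ∪ B)) (g (A ∩ B)) ⟨
      h (A ∪ B) + h (A ∩ B)                                  ∎
      where
      open ≤-Reasoning
      regroup : ∀ a b x y → (a - γ * x) + (b - γ * y) ≡ (a + b) - γ * (x + y)
      regroup a b x y =
        solve 5 (λ a b x y c → (a :- c :* x) :+ (b :- c :* y) := (a :+ b) :- c :* (x :+ y)) refl a b x y γ

    ⊴-supermodular : 0# ≤ γ → ∀ {Y A Q} → Y ∪ A ⊴ Q → Y ∩ A ⊴ A → Y ⊴ Q
    ⊴-supermodular 0≤γ {Y} {A} {Q} = cases
      where
      cancel : h (Y ∪ A) + h (Y ∩ A) < h Q + h A → h Y < h Q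
      cancel lt = +-cancelʳ-< (h A) (≤-<-trans (h-supermodular 0≤γ Y A) lt)
      cases : Y ∪ A ⊴ Q → Y ∩ A ⊴ A → Y ⊴ Q
      cases (inj₁ h[Y∪A]<hQ) Y∩A⊴A            = inj₁ (cancel (+-mono-<-≤ h[Y∪A]<hQ (⊴⇒≤ Y∩A⊴A)))
      cases (inj₂ refl)      (inj₁ h[Y∩A]<hA) = inj₁ (cancel (+-monoʳ-< _ h[Y∩A]<hA))
      cases (inj₂ refl)      (inj₂ Y∩A≡A)     = inj₂ (trans (sym (∪-abs-∩ Y A)) (cong (Y ∪_) Y∩A≡A))

    h-marginal : ∀ X A → h X - h A ≡ (f X - f A) - γ * (g X - g A)
    h-marginal X A = solve 5
      (λ fX fA gX gA c → (fX :- c :* gX) :- (fA :- c :* gA) := (fX :- fA) :- c :* (gX :- gA))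
      refl (f X) (f A) (g X) (g A) γ

    h-densest-≤ : ∀ {A r B} → IsDensestStep R I A r B →
                  ∀ X → A ⊆ X → h X - h A ≤ (r - γ) * (g X - g A)
    h-densest-≤ {A} {r} step X A⊆X = begin
      h X - h A                          ≡⟨ h-marginal X A ⟩
      (f X - f A) - γ * (g X - g A)      ≤⟨ +-monoˡ-≤ _ (densest-≤ step X A⊆X) ⟩
      r * (g X - g A) - γ * (g X - g A)  ≡⟨ sym ([y-z]x≈yx-zx _ r γ) ⟩
      (r - γ) * (g X - g A)              ∎
      where open ≤-Reasoning

    h-densest-≡ : ∀ {A r B} → IsDensestStep R I A r B →
                  h (A ∪ B) - h A ≡ (r - γ) * (g (A ∪ B) - g A)
    h-densest-≡ {A} {r} {B} step = begin
      h (A ∪ B) - h A                                ≡⟨ h-marginal (A ∪ B) A ⟩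
      (f (A ∪ B) - f A) - γ * (g (A ∪ B) - g A)      ≡⟨ cong (_- γ * (g (A ∪ B) - g A)) (densest-≡ step) ⟩
      r * (g (A ∪ B) - g A) - γ * (g (A ∪ B) - g A)  ≡⟨ sym ([y-z]x≈yx-zx _ r γ) ⟩
      (r - γ) * (g (A ∪ B) - g A)                    ∎
      where open ≡-Reasoning

    ⊴-above-densest : ∀ {A r B} → IsDensestStep R I A r B → r < γ → ∀ X → A ⊆ X → X ⊴ A
    ⊴-above-densest {A} {r} step r<γ X A⊆X with p⊆q⇒p≡q∨p⊂q A⊆X
    ... | inj₁ A≡X = inj₂ (sym A≡X)
    ... | inj₂ A⊂X = inj₁ (begin-strict
      h X                          ≡⟨ x≡y+[x-y] (h X) (h A) ⟩
      h A + (h X - h A)            ≤⟨ +-monoʳ-≤ (h A) (h-densest-≤ step X A⊆X) ⟩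
      h A + (r - γ) * (g X - g A)  <⟨ +-monoʳ-< (h A)
                                        (*-monoʳ-<-pos (x<y⇒0<y-x (g-strictmono A X A⊂X)) (x<y⇒x-y<0 r<γ)) ⟩
      h A + 0# * (g X - g A)       ≡⟨ cong (h A +_) (zeroˡ _) ⟩
      h A + 0#                     ≡⟨ +-identityʳ (h A) ⟩
      h A                          ∎)
      where open ≤-Reasoning

    ⊴-below-densest : ∀ {A r B} → IsDensestStep R I A r B → γ < r →
                      ∀ X → A ⊆ X → X ⊆ A ∪ B → X ⊴ A ∪ B
    ⊴-below-densest {A} {r} {B} step γ<r X A⊆X X⊆A∪B with p⊆q⇒p≡q∨p⊂q X⊆A∪B
    ... | inj₁ X≡A∪B = inj₂ X≡A∪B
    ... | inj₂ X⊂A∪B = inj₁ (begin-strict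
      h X                                  ≡⟨ x≡y+[x-y] (h X) (h A) ⟩
      h A + (h X - h A)                    ≤⟨ +-monoʳ-≤ (h A) (h-densest-≤ step X A⊆X) ⟩
      h A + (r - γ) * (g X - g A)          <⟨ +-monoʳ-< (h A) (*-monoˡ-<-pos (x<y⇒0<y-x γ<r)
                                                (+-mono-< (- g A) (g-strictmono X (A ∪ B) X⊂A∪B))) ⟩
      h A + (r - γ) * (g (A ∪ B) - g A)    ≡⟨ cong (h A +_) (sym (h-densest-≡ step)) ⟩
      h A + (h (A ∪ B) - h A)              ≡⟨ sym (x≡y+[x-y] (h (A ∪ B)) (h A)) ⟩
      h (A ∪ B)                            ∎)
      where open ≤-Reasoning

    prefix-⊴ : 0# ≤ γ → ∀ {S : ℕ → Subset n} {ρ : ℕ → Carrier} m →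
               (∀ j → j <ℕ m → IsDensestStep R I (Pre R I S j) (ρ j) (S j) × γ < ρ j) →
               ∀ Y → Y ⊆ Pre R I S m → Y ⊴ Pre R I S m
    prefix-⊴ 0≤γ         zero    _     Y Y⊆⊥   = inj₂ (⊆-antisym Y⊆⊥ ⊥⊆)
    prefix-⊴ 0≤γ {S} {ρ} (suc m) steps Y Y⊆Pre = ⊴-supermodular 0≤γ
      (⊴-below-densest step γ<ρₘ (Y ∪ A) (q⊆p∪q Y A) (∪-least Y⊆Pre (p⊆p∪q (S m))))
      (prefix-⊴ 0≤γ m (λ j j<m → steps j (ℕₚ.m<n⇒m<1+n j<m)) (Y ∩ A) (p∩q⊆q Y A))
      where
      A : Subset n
      A = Pre R I S m
      step : IsDensestStep R I A (ρ m) (S m)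
      step = proj₁ (steps m ℕₚ.≤-refl)
      γ<ρₘ : γ < ρ m
      γ<ρₘ = proj₂ (steps m ℕₚ.≤-refl)

module DensityDecompositionProperties (R : RealField) {n : ℕ} (I : DualModular R n)
  {k : ℕ} {S : ℕ → Subset n} {ρ : ℕ → RealField.Carrier R}
  (D : IsDensityDecomposition R I k S ρ) where
  open RealField R
  open RealFieldProperties R
  open DualModularProperties R I
  open IsDensityDecomposition D

  ρ-antitone : ∀ {j m} → j ≤ℕ m → m <ℕ k → ρ m ≤ ρ j
  ρ-antitone {m = zero} z≤n _ = inj₂ refl
  ρ-antitone {j} {suc m} j≤1+m 1+m<k with ℕₚ.m≤n⇒m<n∨m≡n j≤1+m
  ... | inj₂ refl      = inj₂ refl
  ... | inj₁ (s≤s j≤m) = ≤-trans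
    (densest-antitone (step-max m (ℕₚ.<⇒≤ 1+m<k)) (step-max (suc m) 1+m<k))
    (ρ-antitone j≤m (ℕₚ.<⇒≤ 1+m<k))

lemma4p2 : (R : RealField) → let open RealField R in
    ∀ {n : ℕ} (I : DualModular R n) → let open DualModular I in
    ∀ (k : ℕ) (S : ℕ → Subset n) (ρ : ℕ → Carrier) →
    IsDensityDecomposition R I k S ρ →
    ∀ (γ : Carrier) (i : ℕ) → suc i <ℕ k → γ < ρ i → ρ (suc i) < γ →
    (∀ T → f T - γ * g T ≤ f (Pre R I S (suc i)) - γ * g (Pre R I S (suc i))) ×
    (∀ T → f T - γ * g T ≡ f (Pre R I S (suc i)) - γ * g (Pre R I S (suc i)) →
           T ≡ Pre R I S (suc i))
lemma4p2 R {n} I k S ρ D γ i 1+i<k γ<ρᵢ ρ₁₊ᵢ<γ =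
  (λ T → ⊴⇒≤ (T⊴P T)) , (λ T → ⊴∧h≡⇒≡ (T⊴P T))
  where
  open RealField R
  open RealFieldProperties R
  open DualModularProperties R I
  open Penalised γ
  open IsDensityDecomposition D
  open DensityDecompositionProperties R I D

  P : Subset n
  P = Pre R I S (suc i)

  i<k : i <ℕ k
  i<k = ℕₚ.<⇒≤ 1+i<k

  0≤γ : 0# ≤ γ
  0≤γ = inj₁ (≤-<-trans (densest-nonNeg (step-max (suc i) 1+i<k)) ρ₁₊ᵢ<γ)

  denser-than-γ : ∀ j → j <ℕ suc i → IsDensestStep R I (Pre R I S j) (ρ j) (S j) × γ < ρ j
  denser-than-γ j (s≤s j≤i) =
    step-max j (ℕₚ.≤-<-trans j≤i i<k) , <-≤-trans γ<ρᵢ (ρ-antitone j≤i i<k)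

  T⊴P : ∀ T → T ⊴ P
  T⊴P T = ⊴-supermodular 0≤γ
    (⊴-above-densest (step-max (suc i) 1+i<k) ρ₁₊ᵢ<γ (T ∪ P) (q⊆p∪q T P))
    (prefix-⊴ 0≤γ (suc i) denser-than-γ (T ∩ P) (p∩q⊆q T P))
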